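{- Let $G$ be a graph with no isolated vertices. If $G$ is $5$-$\gamma_{tR}$-edge-critical, then either $G$ is $3$-$\gamma_t$-edge-critical, or $G=K_2\cup K_n$ (disjoint union) for some $n\geq 3$, in which case $G$ is $4$-$\gamma_t$-edge-supercritical.
   Context: All graphs are finite and simple. $\gamma_t(G)$ is the total domination number (minimum size of a set $S$ with every vertex of $G$ adjacent to a vertex of $S$). $G$ is $\gamma_t$-edge-critical if $E(\overline{G})\neq\emptyset$ and $\gamma_t(G+e)<\gamma_t(G)$ for every $e\in E(\overline{G})$, and $k$-$\gamma_t$-edge-critical if also $\gamma_t(G)=k$; $G$ is $\gamma_t$-edge-supercritical if $\gamma_t(G+e)=\gamma_t(G)-2$ for every $e\in E(\overline{G})$ (with $E(\overline{G})\neq\emptyset$), and $k$-$\gamma_t$-edge-supercritical if also $\gamma_t(G)=k$. A total Roman dominating function is a map $f:V(G)\to\{0,1,2\}$ such that every vertex with $f(v)=0$ is adjacent to a vertex $u$ with $f(u)=2$, and the subgraph induced by $\{v:f(v)>0\}$ has no isolated vertices; $\gamma_{tR}(G)$ is the minimum of $\sum_v f(v)$ over such $f$. $G$ is $k$-$\gamma_{tR}$-edge-critical if $\gamma_{tR}(G)=k$, $E(\overline{G})\neq\emptyset$ and $\gamma_{tR}(G+e)<\gamma_{tR}(G)$ for every $e\in E(\overline{G})$. -}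

module Defs where

open import Data.Nat using (ℕ; _≤_; _<_; _≥_; _+_; _∸_)
open import Data.Fin using (Fin; toℕ; zero; suc)
open import Data.Fin.Subset using (Subset; _∈_; ∣_∣)
open import Data.Vec using (sum; tabulate)
open import Data.Product using (Σ; ∃; _×_; _,_)
open import Data.Sum using (_⊎_)
open import Relation.Binary.PropositionalEquality using (_≡_; _≢_)
open import Relation.Nullary using (¬_)
open import Relation.Binary.Definitions using (Decidable)
open import Function.Bundles using (_↔_; Inverse)
open import Level using (0ℓ)

record Graph (n : ℕ) : Set₁ where
  field
    Adj     : Fin n → Fin n → Set
    symm    : ∀ {x y} → Adj x y → Adj y x
    irrefl  : ∀ {x} → ¬ Adj x x
    dec     : Decidable Adj
open Graph public

NoIsolated : ∀ {n} → Graph n → Set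
NoIsolated {n} G = ∀ (v : Fin n) → ∃ λ u → Adj G v u

NonEdge : ∀ {n} → Graph n → Fin n → Fin n → Set
NonEdge G u v = (u ≢ v) × ¬ Adj G u v

addEdge : ∀ {n} (G : Graph n) (u v : Fin n) → NonEdge G u v → Graph n
addEdge {n} G u v (u≢v , _) = record
  { Adj = A
  ; symm = sy
  ; irrefl = irr
  ; dec = d
  }
  where
  open import Data.Fin using (_≟_)
  open import Relation.Nullary.Decidable using (_⊎-dec_; _×-dec_)
  open import Relation.Binary.PropositionalEquality using (refl) renaming (sym to ≡sym)
  open import Data.Sum using (inj₁; inj₂)
  A : Fin n → Fin n → Set
  A x y = Adj G x y ⊎ ((x ≡ u × y ≡ v) ⊎ (x ≡ v × y ≡ u))
  sy : ∀ {x y} → A x y → A y x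
  sy (inj₁ a) = inj₁ (Graph.symm G a)
  sy (inj₂ (inj₁ (p , q))) = inj₂ (inj₂ (q , p))
  sy (inj₂ (inj₂ (p , q))) = inj₂ (inj₁ (q , p))
  irr : ∀ {x} → ¬ A x x
  irr (inj₁ a) = Graph.irrefl G a
  irr (inj₂ (inj₁ (refl , q))) = u≢v q
  irr (inj₂ (inj₂ (refl , q))) = u≢v (≡sym q)
  d : Decidable A
  d x y = Graph.dec G x y ⊎-dec ((x ≟ u ×-dec y ≟ v) ⊎-dec (x ≟ v ×-dec y ≟ u))

IsTDS : ∀ {n} → Graph n → Subset n → Set
IsTDS {n} G S = ∀ (v : Fin n) → ∃ λ u → u ∈ S × Adj G v u

γt≡ : ∀ {n} → Graph n → ℕ → Set
γt≡ G k = (∃ λ S → IsTDS G S × ∣ S ∣ ≡ k) × (∀ S → IsTDS G S → k ≤ ∣ S ∣)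

IsTRDF : ∀ {n} → Graph n → (Fin n → Fin 3) → Set
IsTRDF {n} G f =
  (∀ (v : Fin n) → toℕ (f v) ≡ 0 → ∃ λ u → Adj G v u × toℕ (f u) ≡ 2) ×
  (∀ (v : Fin n) → toℕ (f v) ≢ 0 → ∃ λ u → Adj G v u × toℕ (f u) ≢ 0)

weight : ∀ {n} → (Fin n → Fin 3) → ℕ
weight f = sum (tabulate (λ i → toℕ (f i)))

γtR≡ : ∀ {n} → Graph n → ℕ → Set
γtR≡ G k = (∃ λ f → IsTRDF G f × weight f ≡ k) × (∀ f → IsTRDF G f → k ≤ weight f)

HasNonEdge : ∀ {n} → Graph n → Set
HasNonEdge {n} G = Σ (Fin n) λ u → Σ (Fin n) λ v → NonEdge G u v

γtEdgeCritical : ∀ {n} → ℕ → Graph n → Set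
γtEdgeCritical {n} k G = γt≡ G k × HasNonEdge G ×
  (∀ (u v : Fin n) (e : NonEdge G u v) → ∃ λ m → γt≡ (addEdge G u v e) m × m < k)

γtEdgeSupercritical : ∀ {n} → ℕ → Graph n → Set
γtEdgeSupercritical {n} k G = γt≡ G k × HasNonEdge G ×
  (∀ (u v : Fin n) (e : NonEdge G u v) → γt≡ (addEdge G u v e) (k ∸ 2))

γtREdgeCritical : ∀ {n} → ℕ → Graph n → Set
γtREdgeCritical {n} k G = γtR≡ G k × HasNonEdge G ×
  (∀ (u v : Fin n) (e : NonEdge G u v) → ∃ λ m → γtR≡ (addEdge G u v e) m × m < k)

-- K₂ ∪ Kₘ on Fin (2 + m): vertices 0,1 form K₂, the rest form Kₘ
K2∪K : (m : ℕ) → Graph (2 + m)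
K2∪K m = record { Adj = A ; symm = sy ; irrefl = irr ; dec = d }
  where
  open import Data.Nat using (_≟_; _<?_)
  open import Relation.Nullary.Decidable using (_⊎-dec_; _×-dec_; ¬?)
  open import Relation.Binary.PropositionalEquality using (refl) renaming (sym to ≡sym)
  open import Data.Sum using (inj₁; inj₂)
  A : Fin (2 + m) → Fin (2 + m) → Set
  A x y = ¬ (toℕ x ≡ toℕ y) × ((toℕ x < 2 × toℕ y < 2) ⊎ (¬ toℕ x < 2 × ¬ toℕ y < 2))
  sy : ∀ {x y} → A x y → A y x
  sy (ne , inj₁ (a , b)) = (λ e → ne (≡sym e)) , inj₁ (b , a)
  sy (ne , inj₂ (a , b)) = (λ e → ne (≡sym e)) , inj₂ (b , a)
  irr : ∀ {x} → ¬ A x x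
  irr (ne , _) = ne refl
  d : Decidable A
  d x y = ¬? (toℕ x ≟ toℕ y) ×-dec ((toℕ x <? 2 ×-dec toℕ y <? 2) ⊎-dec (¬? (toℕ x <? 2) ×-dec ¬? (toℕ y <? 2)))

_≅_ : ∀ {n m} → Graph n → Graph m → Set
_≅_ {n} {m} G H = Σ (Fin n ↔ Fin m) λ φ →
  ∀ (x y : Fin n) → (Adj G x y → Adj H (Inverse.to φ x) (Inverse.to φ y)) ×
                    (Adj H (Inverse.to φ x) (Inverse.to φ y) → Adj G x y)

module Submission where

-- A TRDF of weight at most 4 on at least five vertices labels some vertex a with 2 and a
-- neighbour b of a positively, and then a and b already totally dominate; conversely,
-- labelling a dominating pair with 2 gives weight 4. Hence G has no dominating pair, while
-- every G + e has one, so γt(G + e) = 2. If some triple dominates G, then γt(G) = 3. Otherwise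
-- the dominating pair of G + uv must be {u, v} itself, so N[u] ∪ N[v] = V and u, v have no
-- common neighbour, for every non-edge uv; such a graph is the disjoint union of the cliques
-- N[u] and N[v]. A TRDF puts weight at least 3 on every clique with three vertices, so one of
-- the two cliques is a K₂, and γt(G) = 4.

open import Defs
open import Algebra.Properties.CommutativeSemigroup using (x∙yz≈y∙xz)
open import Data.Bool using (if_then_else_)
open import Data.Empty using (⊥; ⊥-elim)
open import Data.Fin using (Fin; zero; suc; toℕ; _≟_)
open import Data.Fin.Patterns using (0F; 1F; 2F)
open import Data.Fin.Permutation using (Permutation′; _⟨$⟩ʳ_; _∘ₚ_; transpose)
import Data.Fin.Permutation.Components as PC
open import Data.Fin.Properties using (any?; all?; toℕ≤pred[n]; toℕ-injective)
open import Data.Fin.Subset using (Subset; ∣_∣; ⁅_⁆; _∪_; ⋃; inside; outside; _-_)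
  renaming (_∈_ to _∈ˢ_)
open import Data.Fin.Subset.Properties
  using (x∈⁅x⁆; x∈p∪q⁺; ∣p∣≤∣x∷p∣; ∪-identityˡ; ∣⊥∣≡0; x∈p⇒∣p-x∣<∣p∣; x∈p∧x≢y⇒x∈p-y)
  renaming (_∈?_ to _∈ˢ?_)
open import Data.List using (List; []; _∷_; map; length; filter; allFin; _++_; deduplicate)
open import Data.List.Membership.Propositional using (lose; find) renaming (_∈_ to _∈ₗ_)
import Data.List.Membership.DecPropositional as DecMembership
open import Data.List.Membership.Propositional.Properties using (∈-filter⁺; ∈-filter⁻; ∈-allFin)
open import Data.List.Properties using (map-cong-local; length-deduplicate; map-++)
open import Data.List.Relation.Binary.Disjoint.Propositional using (Disjoint)
open import Data.List.Relation.Binary.Subset.Propositional using (_⊆_)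
open import Data.List.Relation.Binary.Subset.Propositional.Properties using (Any-resp-⊆)
open import Data.List.Relation.Unary.All as All using (All; []; _∷_)
open import Data.List.Relation.Unary.AllPairs using ([]; _∷_)
open import Data.List.Relation.Unary.Any as Any using (Any; here; there)
import Data.List.Relation.Unary.Any.Properties as Any
open import Data.List.Relation.Unary.Unique.Propositional using (Unique)
import Data.List.Relation.Unary.Unique.Propositional.Properties as Unique
import Data.List.Relation.Unary.Unique.DecPropositional.Properties as DecUnique
open import Data.Nat using (ℕ; zero; suc; _+_; _*_; _≤_; _<_; _≥_; z≤n; s≤s) renaming (_≟_ to _≟ℕ_)
open import Data.Nat.ListAction using (sum)
open import Data.Nat.ListAction.Properties using (sum-++)
open import Data.Nat.Properties
  using ( +-mono-≤; +-monoʳ-≤; ≤-refl; ≤-reflexive; ≤-trans; ≤-antisym; ≤-<-trans; ≤-pred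
        ; ≮⇒≥; <⇒≢; <⇒≱; n≢0⇒n>0; *-zeroʳ; *-identityʳ; +-commutativeSemigroup; module ≤-Reasoning)
open import Data.Product using (Σ; ∃; ∃₂; _×_; _,_; proj₁; proj₂)
open import Data.Sum using (_⊎_; inj₁; inj₂; fromInj₂)
open import Data.Vec using (tabulate) renaming (_∷_ to _∷ᵥ_; sum to sumᵥ)
open import Data.Vec.Functional using (updateAt)
open import Data.Vec.Functional.Properties using (updateAt-updates; updateAt-minimal)
open import Function using (_∘_; const; id)
open import Function.Bundles using (Injection)
open import Function.Properties.Inverse using (↔⇒↣)
open import Relation.Binary.PropositionalEquality
  using (_≡_; _≢_; refl; sym; trans; cong; subst; ≢-sym; module ≡-Reasoning)
open import Relation.Nullary using (¬_; Dec; does; yes; no; contradiction)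
open import Relation.Nullary.Decidable
  using (_⊎-dec_; _×-dec_; ¬?; dec-true; dec-false; decidable-stable)

private variable
  n : ℕ

total : (Fin n → ℕ) → ℕ
total h = sumᵥ (tabulate h)

total-const : ∀ n c → total {n} (const c) ≡ n * c
total-const zero    c = refl
total-const (suc n) c = cong (c +_) (total-const n c)

total-mono : ∀ {h k : Fin n → ℕ} → (∀ i → h i ≤ k i) → total h ≤ total k
total-mono {zero}  h≤k = z≤n
total-mono {suc n} h≤k = +-mono-≤ (h≤k 0F) (total-mono (h≤k ∘ suc))

total-updateAt : ∀ (h : Fin n → ℕ) x → total h ≡ h x + total (updateAt h x (const 0))
total-updateAt h zero    = refl
total-updateAt h (suc x) = begin
  h 0F + total (h ∘ suc)          ≡⟨ cong (h 0F +_) (total-updateAt (h ∘ suc) x) ⟩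
  h 0F + (h (suc x) + total h′)   ≡⟨ x∙yz≈y∙xz +-commutativeSemigroup (h 0F) (h (suc x)) _ ⟩
  h (suc x) + (h 0F + total h′)   ∎
  where
  open ≡-Reasoning
  h′ = updateAt (h ∘ suc) x (const 0)

sum-map-mono : ∀ {A : Set} {h k : A → ℕ} xs → (∀ i → h i ≤ k i) → sum (map h xs) ≤ sum (map k xs)
sum-map-mono []       h≤k = z≤n
sum-map-mono (x ∷ xs) h≤k = +-mono-≤ (h≤k x) (sum-map-mono xs h≤k)

sum-map≤length* : ∀ {A : Set} {h : A → ℕ} {c} xs → (∀ i → h i ≤ c) → sum (map h xs) ≤ length xs * c
sum-map≤length* []       h≤c = z≤n
sum-map≤length* (x ∷ xs) h≤c = +-mono-≤ (h≤c x) (sum-map≤length* xs h≤c)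

sum-map≤total : ∀ (h : Fin n → ℕ) {xs} → Unique xs → sum (map h xs) ≤ total h
sum-map≤total h []                    = z≤n
sum-map≤total h {x ∷ xs} (x∉xs ∷ !xs) = begin
  h x + sum (map h xs)  ≡⟨ cong (λ ys → h x + sum ys) (map-cong-local (All.map unchanged x∉xs)) ⟩
  h x + sum (map h′ xs) ≤⟨ +-monoʳ-≤ (h x) (sum-map≤total h′ !xs) ⟩
  h x + total h′        ≡⟨ total-updateAt h x ⟨
  total h               ∎
  where
  open ≤-Reasoning
  h′ = updateAt h x (const 0)
  unchanged : ∀ {y} → x ≢ y → h y ≡ h′ y
  unchanged x≢y = sym (updateAt-minimal _ x h (x≢y ∘ sym))

total≤sum-map : ∀ (h : Fin n → ℕ) xs → (∀ i → h i ≢ 0 → i ∈ₗ xs) → total h ≤ sum (map h xs)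
total≤sum-map {n} h [] support = begin
  total h             ≤⟨ total-mono (λ i → ≮⇒≥ (λ 0<hi → ∉[] (support i (≢-sym (<⇒≢ 0<hi))))) ⟩
  total {n} (const 0) ≡⟨ total-const n 0 ⟩
  n * 0               ≡⟨ *-zeroʳ n ⟩
  0                   ∎
  where
  open ≤-Reasoning
  ∉[] : ∀ {i} → ¬ i ∈ₗ []
  ∉[] ()
total≤sum-map h (x ∷ xs) support = begin
  total h               ≡⟨ total-updateAt h x ⟩
  h x + total h′        ≤⟨ +-monoʳ-≤ (h x) (total≤sum-map h′ xs support′) ⟩
  h x + sum (map h′ xs) ≤⟨ +-monoʳ-≤ (h x) (sum-map-mono xs h′≤h) ⟩
  h x + sum (map h xs)  ∎
  where
  open ≤-Reasoning
  h′ = updateAt h x (const 0)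
  h′≤h : ∀ i → h′ i ≤ h i
  h′≤h i with i ≟ x
  ... | yes refl = ≤-trans (≤-reflexive (updateAt-updates x h)) z≤n
  ... | no i≢x   = ≤-reflexive (updateAt-minimal i x h i≢x)
  support′ : ∀ i → h′ i ≢ 0 → i ∈ₗ xs
  support′ i h′i≢0 with i ≟ x
  ... | yes refl = contradiction (updateAt-updates x h) h′i≢0
  ... | no i≢x with support i (subst (_≢ 0) (updateAt-minimal i x h i≢x) h′i≢0)
  ...   | here i≡x   = contradiction i≡x i≢x
  ...   | there i∈xs = i∈xs

total-ones : total {n} (const 1) ≡ n
total-ones {n} = trans (total-const n 1) (*-identityʳ n)

n≤total : ∀ {h : Fin n → ℕ} → (∀ i → h i ≢ 0) → n ≤ total h
n≤total {n} {h} h≢0 = subst (_≤ total h) total-ones (total-mono (n≢0⇒n>0 ∘ h≢0))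

fromList : List (Fin n) → Subset n
fromList xs = ⋃ (map ⁅_⁆ xs)

∈-fromList⁺ : ∀ {x : Fin n} {xs} → x ∈ₗ xs → x ∈ˢ fromList xs
∈-fromList⁺ {x = x} (here refl) = x∈p∪q⁺ (inj₁ (x∈⁅x⁆ x))
∈-fromList⁺ (there x∈xs)        = x∈p∪q⁺ (inj₂ (∈-fromList⁺ x∈xs))

∣⁅x⁆∪p∣≤1+∣p∣ : ∀ {n} (x : Fin n) p → ∣ ⁅ x ⁆ ∪ p ∣ ≤ suc ∣ p ∣
∣⁅x⁆∪p∣≤1+∣p∣ zero    (s ∷ᵥ p)       rewrite ∪-identityˡ p = s≤s (∣p∣≤∣x∷p∣ s p)
∣⁅x⁆∪p∣≤1+∣p∣ (suc x) (outside ∷ᵥ p) = ∣⁅x⁆∪p∣≤1+∣p∣ x p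
∣⁅x⁆∪p∣≤1+∣p∣ (suc x) (inside ∷ᵥ p)  = s≤s (∣⁅x⁆∪p∣≤1+∣p∣ x p)

∣fromList∣≤length : ∀ (xs : List (Fin n)) → ∣ fromList xs ∣ ≤ length xs
∣fromList∣≤length {n} []   = ≤-reflexive (∣⊥∣≡0 n)
∣fromList∣≤length (x ∷ xs) = ≤-trans (∣⁅x⁆∪p∣≤1+∣p∣ x (fromList xs)) (s≤s (∣fromList∣≤length xs))

length≤∣p∣ : ∀ {p : Subset n} {xs} → Unique xs → All (_∈ˢ p) xs → length xs ≤ ∣ p ∣
length≤∣p∣ []           []           = z≤n
length≤∣p∣ {p = p} {x ∷ _} (x∉xs ∷ !xs) (x∈p ∷ xs⊆p) =
  ≤-trans (s≤s (length≤∣p∣ !xs (All.zipWith in-p-x (xs⊆p , x∉xs)))) (x∈p⇒∣p-x∣<∣p∣ x∈p)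
  where
  in-p-x : ∀ {y} → y ∈ˢ p × x ≢ y → y ∈ˢ p - x
  in-p-x (y∈p , x≢y) = x∈p∧x≢y⇒x∈p-y y∈p (x≢y ∘ sym)

elements : Subset n → List (Fin n)
elements p = filter (_∈ˢ? p) (allFin _)

elements-unique : ∀ (p : Subset n) → Unique (elements p)
elements-unique p = Unique.filter⁺ (_∈ˢ? p) (Unique.allFin⁺ _)

elements⊆ : ∀ (p : Subset n) → All (_∈ˢ p) (elements p)
elements⊆ p = All.tabulate (proj₂ ∘ ∈-filter⁻ (_∈ˢ? p) {xs = allFin _})

∈-elements : ∀ {p : Subset n} {x} → x ∈ˢ p → x ∈ₗ elements p
∈-elements {p = p} {x} x∈p = ∈-filter⁺ (_∈ˢ? p) (∈-allFin x) x∈p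

_∈ₗ?_ : ∀ (x : Fin n) xs → Dec (x ∈ₗ xs)
_∈ₗ?_ = DecMembership._∈?_ _≟_

Dominates : Graph n → List (Fin n) → Set
Dominates G xs = ∀ w → Any (Adj G w) xs

dominates? : (G : Graph n) → ∀ xs → Dec (Dominates G xs)
dominates? G xs = all? (λ w → Any.any? (dec G w) xs)

fromList-isTDS : ∀ (G : Graph n) {xs} → Dominates G xs → IsTDS G (fromList xs)
fromList-isTDS G dom w with find (dom w)
... | x , x∈xs , wx = x , ∈-fromList⁺ x∈xs , wx

elements-dominate : ∀ (G : Graph n) {p} → IsTDS G p → Dominates G (elements p)
elements-dominate G tds w with tds w
... | x , x∈p , wx = lose (∈-elements x∈p) wx

-- A dominating list keeps its length under deduplication, by minimality, and the elements of
-- a total dominating set form a dominating list.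
γt≡-intro : ∀ (G : Graph n) {xs} → Dominates G xs →
            (∀ ys → length ys < length xs → ¬ Dominates G ys) → γt≡ G (length xs)
γt≡-intro {n} G {xs} dom minimal = (fromList ds , fromList-isTDS G ds-dom , card-ds) , lower
  where
  ds = deduplicate _≟_ xs
  ds-dom : Dominates G ds
  ds-dom w = Any.deduplicate⁺ _≟_ (λ { refl → id }) (dom w)
  length-ds : length ds ≡ length xs
  length-ds = ≤-antisym (length-deduplicate _≟_ xs) (≮⇒≥ (λ lt → minimal ds lt ds-dom))
  card-ds : ∣ fromList ds ∣ ≡ length xs
  card-ds = trans (≤-antisym (∣fromList∣≤length ds) (length≤∣p∣ ds-unique (All.tabulate ∈-fromList⁺)))
                  length-ds
    where ds-unique = DecUnique.deduplicate-! (_≟_ {n}) xs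
  lower : ∀ p → IsTDS G p → length xs ≤ ∣ p ∣
  lower p tds = ≮⇒≥ λ ∣p∣<k →
    minimal (elements p) (≤-<-trans (length≤∣p∣ (elements-unique p) (elements⊆ p)) ∣p∣<k)
            (elements-dominate G tds)

NoDominatingPair : Graph n → Set
NoDominatingPair G = ∀ a b → ¬ Dominates G (a ∷ b ∷ [])

NoDominatingTriple : Graph n → Set
NoDominatingTriple G = ∀ a b c → ¬ Dominates G (a ∷ b ∷ c ∷ [])

-- Total Roman dominating functions

γtR≤order : ∀ (G : Graph n) → NoIsolated G → ∀ {k} → (∀ f → IsTRDF G f → k ≤ weight f) → k ≤ n
γtR≤order G noIsolated minimal = subst (_ ≤_) total-ones (minimal (const 1F) ones-isTRDF)
  where
  ones-isTRDF : IsTRDF G (const 1F)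
  ones-isTRDF = (λ _ ()) , λ v _ → proj₁ (noIsolated v) , proj₂ (noIsolated v) , λ ()

twoOn : List (Fin n) → Fin n → Fin 3
twoOn xs i = if does (i ∈ₗ? xs) then 2F else 0F

twoOn-∈ : ∀ {x : Fin n} {xs} → x ∈ₗ xs → toℕ (twoOn xs x) ≡ 2
twoOn-∈ {x = x} {xs} x∈xs rewrite dec-true (x ∈ₗ? xs) x∈xs = refl

twoOn-support : ∀ (xs : List (Fin n)) i → toℕ (twoOn xs i) ≢ 0 → i ∈ₗ xs
twoOn-support xs i twoOn≢0 with i ∈ₗ? xs
... | yes i∈xs = i∈xs
... | no _     = contradiction refl twoOn≢0

dominates⇒TRDF : ∀ (G : Graph n) {xs} → Dominates G xs →
                 ∃ λ f → IsTRDF G f × weight f ≤ length xs * 2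
dominates⇒TRDF G {xs} dom =
  twoOn xs , ((λ v _ → twoNeighbour v) , (λ v _ → positiveNeighbour v)) , weight≤
  where
  twoNeighbour : ∀ v → ∃ λ u → Adj G v u × toℕ (twoOn xs u) ≡ 2
  twoNeighbour v with find (dom v)
  ... | x , x∈xs , vx = x , vx , twoOn-∈ x∈xs
  positiveNeighbour : ∀ v → ∃ λ u → Adj G v u × toℕ (twoOn xs u) ≢ 0
  positiveNeighbour v with twoNeighbour v
  ... | u , vu , fu≡2 = u , vu , λ fu≡0 → contradiction (trans (sym fu≡2) fu≡0) λ ()
  weight≤ : weight (twoOn xs) ≤ length xs * 2
  weight≤ = ≤-trans (total≤sum-map _ xs (twoOn-support xs))
                    (sum-map≤length* xs (toℕ≤pred[n] ∘ twoOn xs))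

weight<order⇒two : ∀ (G : Graph n) {f} → IsTRDF G f → weight f < n → ∃ λ a → toℕ (f a) ≡ 2
weight<order⇒two {n} G {f} (zero⇒two , _) weight<n with any? (λ a → toℕ (f a) ≟ℕ 2)
... | yes two = two
... | no noTwo = contradiction (n≤total noZero) (<⇒≱ weight<n)
  where
  noZero : ∀ i → toℕ (f i) ≢ 0
  noZero i fi≡0 = noTwo (proj₁ (zero⇒two i fi≡0) , proj₂ (proj₂ (zero⇒two i fi≡0)))

-- a is labelled 2 and b is positive; a vertex dominated by neither of them would exhibit
-- weight 2 + 1 + 2 or 2 + 1 + 1 + 1 on distinct vertices.
lightTRDF⇒dominatingPair : ∀ (G : Graph n) {f} → 5 ≤ n → IsTRDF G f → weight f ≤ 4 →
                           ∃₂ λ a b → Dominates G (a ∷ b ∷ [])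
lightTRDF⇒dominatingPair {n} G {f} 5≤n isTRDF@(zero⇒two , positive⇒positive) weight≤4
  with weight<order⇒two G isTRDF (≤-trans (s≤s weight≤4) 5≤n)
... | a , fa≡2 = a , b , dominated
  where
  h = toℕ ∘ f
  heavy : ∀ {ys} → Unique ys → 5 ≤ sum (map h ys) → ⊥
  heavy !ys 5≤ = <⇒≱ (s≤s weight≤4) (≤-trans 5≤ (sum-map≤total h !ys))
  fa≢0 : h a ≢ 0
  fa≢0 fa≡0 = contradiction (trans (sym fa≡2) fa≡0) λ ()
  b = proj₁ (positive⇒positive a fa≢0)
  ab = proj₁ (proj₂ (positive⇒positive a fa≢0))
  fb≥1 = n≢0⇒n>0 (proj₂ (proj₂ (positive⇒positive a fa≢0)))
  a≢b = λ a≡b → irrefl G (subst (Adj G a) (sym a≡b) ab)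
  viaTwo : ∀ {w} → (∃ λ c → Adj G w c × h c ≡ 2) → Any (Adj G w) (a ∷ b ∷ [])
  viaTwo (c , wc , fc≡2) with c ≟ a | c ≟ b
  ... | yes refl | _        = here wc
  ... | _        | yes refl = there (here wc)
  ... | no c≢a   | no c≢b   = ⊥-elim (heavy
    ((a≢b ∷ ≢-sym c≢a ∷ []) ∷ (≢-sym c≢b ∷ []) ∷ [] ∷ [])
    (+-mono-≤ (≤-reflexive (sym fa≡2)) (+-mono-≤ fb≥1 (+-mono-≤ (≤-reflexive (sym fc≡2)) z≤n))))
  viaPositive : ∀ {w} → h w ≢ 0 → (∃ λ x → Adj G w x × h x ≢ 0) → Any (Adj G w) (a ∷ b ∷ [])
  viaPositive {w} fw≢0 (x , wx , fx≢0) with x ≟ a | x ≟ b | w ≟ a | w ≟ b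
  ... | yes refl | _        | _        | _        = here wx
  ... | _        | yes refl | _        | _        = there (here wx)
  ... | _        | _        | yes refl | _        = there (here ab)
  ... | _        | _        | _        | yes refl = here (symm G ab)
  ... | no x≢a   | no x≢b   | no w≢a   | no w≢b   = ⊥-elim (heavy
    ((a≢b ∷ ≢-sym w≢a ∷ ≢-sym x≢a ∷ []) ∷ (≢-sym w≢b ∷ ≢-sym x≢b ∷ []) ∷ (w≢x ∷ []) ∷ [] ∷ [])
    (+-mono-≤ (≤-reflexive (sym fa≡2))
      (+-mono-≤ fb≥1 (+-mono-≤ (n≢0⇒n>0 fw≢0) (+-mono-≤ (n≢0⇒n>0 fx≢0) z≤n)))))
    where w≢x = λ w≡x → irrefl G (subst (Adj G w) (sym w≡x) wx)
  dominated : Dominates G (a ∷ b ∷ [])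
  dominated w with h w ≟ℕ 0
  ... | yes fw≡0 = viaTwo (zero⇒two w fw≡0)
  ... | no fw≢0  = viaPositive fw≢0 (positive⇒positive w fw≢0)

N⟨_⟩[_] : Graph n → Fin n → Fin n → Set
N⟨ G ⟩[ u ] w = w ≡ u ⊎ Adj G u w

Splits : Graph n → Fin n → Fin n → Set
Splits G u v = (∀ w → N⟨ G ⟩[ u ] w ⊎ N⟨ G ⟩[ v ] w) × (∀ x → Adj G u x → Adj G v x → ⊥)

module _ (G : Graph n) {u v} (uv : NonEdge G u v) where

  private
    G+uv = addEdge G u v uv

  adj-addEdge⁻ : ∀ {x w z} → x ≡ u ⊎ x ≡ v → w ≢ x → z ≢ x → Adj G+uv w z → Adj G w z
  adj-addEdge⁻ _           _   _   (inj₁ wz)                = wz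
  adj-addEdge⁻ (inj₁ refl) w≢u _   (inj₂ (inj₁ (w≡u , _))) = contradiction w≡u w≢u
  adj-addEdge⁻ (inj₂ refl) _   z≢v (inj₂ (inj₁ (_ , z≡v))) = contradiction z≡v z≢v
  adj-addEdge⁻ (inj₁ refl) _   z≢u (inj₂ (inj₂ (_ , z≡u))) = contradiction z≡u z≢u
  adj-addEdge⁻ (inj₂ refl) w≢v _   (inj₂ (inj₂ (w≡v , _))) = contradiction w≡v w≢v

  dominates-addEdge⁻ : ∀ {x x′ xs} → x ≡ u ⊎ x ≡ v → ¬ x ∈ₗ xs → Adj G x x′ →
                       Dominates G+uv xs → Dominates G (x′ ∷ xs)
  dominates-addEdge⁻ {x} x∈uv x∉xs xx′ dom w with w ≟ x | find (dom w)
  ... | yes refl | _             = here xx′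
  ... | no w≢x   | z , z∈xs , wz = there (lose z∈xs (adj-addEdge⁻ x∈uv w≢x z≢x wz))
    where z≢x = λ { refl → x∉xs z∈xs }

  private
    pair⊆pair : ∀ {a b} → u ∈ₗ a ∷ b ∷ [] → v ∈ₗ a ∷ b ∷ [] → a ∷ b ∷ [] ⊆ u ∷ v ∷ []
    pair⊆pair (here u≡a)          (here v≡a)          = contradiction (trans u≡a (sym v≡a)) (proj₁ uv)
    pair⊆pair (here refl)         (there (here refl)) = id
    pair⊆pair (there (here refl)) (here refl)         = λ { (here refl)         → there (here refl)
                                                          ; (there (here refl)) → here refl }
    pair⊆pair (there (here u≡b))  (there (here v≡b))  = contradiction (trans u≡b (sym v≡b)) (proj₁ uv)

  -- If u were missing from the dominating pair of G + uv, a neighbour of u would complete it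
  -- to a dominating triple of G; likewise for v.
  splits-of-dominatingPair : NoIsolated G → NoDominatingTriple G →
                             ∀ {a b} → Dominates G+uv (a ∷ b ∷ []) → Splits G u v
  splits-of-dominatingPair noIsolated noTriple {a} {b} dom = cover , noCommonNeighbour
    where
    u≢v = proj₁ uv
    inPair : ∀ {x} → x ≡ u ⊎ x ≡ v → x ∈ₗ a ∷ b ∷ []
    inPair {x} x∈uv = decidable-stable (x ∈ₗ? _) λ x∉ab →
      noTriple _ a b (dominates-addEdge⁻ x∈uv x∉ab (proj₂ (noIsolated x)) dom)
    adjacentTo-u∨v : ∀ {w} → w ≢ u → w ≢ v → Any (Adj G w) (u ∷ v ∷ [])
    adjacentTo-u∨v {w} w≢u w≢v
      with Any-resp-⊆ (pair⊆pair (inPair (inj₁ refl)) (inPair (inj₂ refl))) (dom w)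
    ... | here wu         = here (adj-addEdge⁻ (inj₂ refl) w≢v u≢v wu)
    ... | there (here wv) = there (here (adj-addEdge⁻ (inj₁ refl) w≢u (≢-sym u≢v) wv))
    cover : ∀ w → N⟨ G ⟩[ u ] w ⊎ N⟨ G ⟩[ v ] w
    cover w with w ≟ u | w ≟ v
    ... | yes w≡u | _       = inj₁ (inj₁ w≡u)
    ... | _       | yes w≡v = inj₂ (inj₁ w≡v)
    ... | no w≢u  | no w≢v  with adjacentTo-u∨v w≢u w≢v
    ...   | here wu         = inj₁ (inj₂ (symm G wu))
    ...   | there (here wv) = inj₂ (inj₂ (symm G wv))
    noCommonNeighbour : ∀ x → Adj G u x → Adj G v x → ⊥
    noCommonNeighbour x ux vx = noTriple u v x uvx-dominates
      where
      uvx-dominates : Dominates G (u ∷ v ∷ x ∷ [])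
      uvx-dominates w with w ≟ u | w ≟ v
      ... | yes refl | _        = there (there (here ux))
      ... | _        | yes refl = there (there (here vx))
      ... | no w≢u   | no w≢v   = Any.++⁺ˡ (adjacentTo-u∨v w≢u w≢v)

-- Graphs in which every non-edge splits

SameSide : ∀ {A : Set} → (A → Set) → A → A → Set
SameSide P x y = (P x × P y) ⊎ (¬ P x × ¬ P y)

NonEdge-sym : ∀ (G : Graph n) {u v} → NonEdge G u v → NonEdge G v u
NonEdge-sym G (u≢v , ¬uv) = ≢-sym u≢v , ¬uv ∘ symm G

module TwoCliques (G : Graph n) (split : ∀ {u v} → NonEdge G u v → Splits G u v) where

  private
    N[_] = N⟨ G ⟩[_]

  outside⇒NonEdge : ∀ {u y} → ¬ N[ u ] y → NonEdge G u y
  outside⇒NonEdge y∉N[u] = (λ u≡y → y∉N[u] (inj₁ (sym u≡y))) , y∉N[u] ∘ inj₂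

  disjoint : ∀ {u v w} → NonEdge G u v → N[ u ] w → N[ v ] w → ⊥
  disjoint (u≢v , _  ) (inj₁ refl) (inj₁ u≡v) = u≢v u≡v
  disjoint (_   , ¬uv) (inj₁ refl) (inj₂ vu)   = ¬uv (symm G vu)
  disjoint (_   , ¬uv) (inj₂ uv)   (inj₁ refl) = ¬uv uv
  disjoint uv          (inj₂ uw)   (inj₂ vw)   = proj₂ (split uv) _ uw vw

  -- x would be a common neighbour of u and y, which are non-adjacent once y ∈ N[v].
  closed : ∀ {u v x y} → NonEdge G u v → N[ u ] x → N[ x ] y → N[ u ] y
  closed uv ux          (inj₁ refl) = ux
  closed uv (inj₁ refl) (inj₂ uy)   = inj₂ uy
  closed {x = x} {y} uv (inj₂ ux) (inj₂ xy) with proj₁ (split uv) y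
  ... | inj₁ uy = uy
  ... | inj₂ vy = ⊥-elim (proj₂ (split uy-nonEdge) x ux (symm G xy))
    where uy-nonEdge = outside⇒NonEdge (λ uy → disjoint uv uy vy)

  -- Splitting a non-edge xy would put v into N[x] ∪ N[y] ⊆ N[u].
  clique : ∀ {u v x y} → NonEdge G u v → N[ u ] x → N[ u ] y → x ≢ y → Adj G x y
  clique {v = v} {x} {y} uv ux uy x≢y with dec G x y
  ... | yes xy = xy
  ... | no ¬xy with proj₁ (split (x≢y , ¬xy)) v
  ...   | inj₁ xv = ⊥-elim (disjoint uv (closed uv ux xv) (inj₁ refl))
  ...   | inj₂ yv = ⊥-elim (disjoint uv (closed uv uy yv) (inj₁ refl))

  adj⇒sameSide : ∀ {u v x y} → NonEdge G u v → Adj G x y → SameSide N[ u ] x y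
  adj⇒sameSide {x = x} uv xy with proj₁ (split uv) x
  ... | inj₁ ux = inj₁ (ux , closed uv ux (inj₂ xy))
  ... | inj₂ vx = inj₂ ((λ ux → disjoint uv ux vx)
                       , (λ uy → disjoint uv uy (closed (NonEdge-sym G uv) vx (inj₂ xy))))

  sameSide⇒adj : ∀ {u v x y} → NonEdge G u v → x ≢ y → SameSide N[ u ] x y → Adj G x y
  sameSide⇒adj uv x≢y (inj₁ (ux , uy))   = clique uv ux uy x≢y
  sameSide⇒adj uv x≢y (inj₂ (¬ux , ¬uy)) =
    clique (NonEdge-sym G uv) (other ¬ux) (other ¬uy) x≢y
    where
    other : ∀ {w} → ¬ N[ _ ] w → N[ _ ] w
    other {w} ¬uw = fromInj₂ (λ uw → contradiction uw ¬uw) (proj₁ (split uv) w)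

Carries : (Fin n → Fin 3) → (Fin n → Set) → ℕ → Set
Carries f C k = ∃ λ ys → Unique ys × All C ys × k ≤ sum (map (toℕ ∘ f) ys)

carries-disjoint : ∀ {f : Fin n → Fin 3} {C D k l} → (∀ {w} → C w → D w → ⊥) →
                   Carries f C k → Carries f D l → k + l ≤ weight f
carries-disjoint {f = f} {k = k} {l} C∩D=∅ (xs , !xs , Cxs , k≤) (ys , !ys , Dys , l≤) = begin
  k + l                           ≤⟨ +-mono-≤ k≤ l≤ ⟩
  sum (map h xs) + sum (map h ys) ≡⟨ sum-++ (map h xs) (map h ys) ⟨
  sum (map h xs ++ map h ys)      ≡⟨ cong sum (map-++ h xs ys) ⟨
  sum (map h (xs ++ ys))          ≤⟨ sum-map≤total h (Unique.++⁺ !xs !ys disjoint) ⟩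
  weight f                        ∎
  where
  open ≤-Reasoning
  h = toℕ ∘ f
  disjoint : Disjoint xs ys
  disjoint (x∈xs , x∈ys) = C∩D=∅ (All.lookup Cxs x∈xs) (All.lookup Dys x∈ys)

module _ (G : Graph n) {f} (isTRDF : IsTRDF G f) {C : Fin n → Set}
         (closed : ∀ {x y} → C x → Adj G x y → C y) where

  private
    h = toℕ ∘ f
    zero⇒two = proj₁ isTRDF
    positive⇒positive = proj₂ isTRDF

  zero-carries3 : ∀ {w} → C w → h w ≡ 0 → Carries f C 3
  zero-carries3 {w} Cw fw≡0 with zero⇒two w fw≡0
  ... | c , wc , fc≡2 with positive⇒positive c (λ fc≡0 → contradiction (trans (sym fc≡2) fc≡0) λ ())
  ...   | d , cd , fd≢0 =
    (c ∷ d ∷ []) , ((c≢d ∷ []) ∷ [] ∷ []) , (Cc ∷ closed Cc cd ∷ []) ,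
    +-mono-≤ (≤-reflexive (sym fc≡2)) (+-mono-≤ (n≢0⇒n>0 fd≢0) z≤n)
    where
    Cc = closed Cw wc
    c≢d = λ c≡d → irrefl G (subst (Adj G c) (sym c≡d) cd)

  closedSet-carries3 : ∀ {x y z} → C x → C y → C z → x ≢ y → x ≢ z → y ≢ z → Carries f C 3
  closedSet-carries3 {x} {y} {z} Cx Cy Cz x≢y x≢z y≢z with h x ≟ℕ 0 | h y ≟ℕ 0 | h z ≟ℕ 0
  ... | yes fx≡0 | _        | _        = zero-carries3 Cx fx≡0
  ... | _        | yes fy≡0 | _        = zero-carries3 Cy fy≡0
  ... | _        | _        | yes fz≡0 = zero-carries3 Cz fz≡0
  ... | no fx≢0  | no fy≢0  | no fz≢0  =
    (x ∷ y ∷ z ∷ []) , ((x≢y ∷ x≢z ∷ []) ∷ (y≢z ∷ []) ∷ [] ∷ []) , (Cx ∷ Cy ∷ Cz ∷ []) ,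
    +-mono-≤ (n≢0⇒n>0 fx≢0) (+-mono-≤ (n≢0⇒n>0 fy≢0) (+-mono-≤ (n≢0⇒n>0 fz≢0) z≤n))

SameSide-map : ∀ {A : Set} {P Q : A → Set} {x y} → (∀ {z} → P z → Q z) → (∀ {z} → Q z → P z) →
               SameSide P x y → SameSide Q x y
SameSide-map P⇒Q Q⇒P (inj₁ (Px , Py))   = inj₁ (P⇒Q Px , P⇒Q Py)
SameSide-map P⇒Q Q⇒P (inj₂ (¬Px , ¬Py)) = inj₂ (¬Px ∘ Q⇒P , ¬Py ∘ Q⇒P)

transpose-sends : ∀ (i j : Fin n) → PC.transpose i j i ≡ j
transpose-sends i j rewrite dec-true (i ≟ i) refl = refl

transpose-fixes : ∀ {i j k : Fin n} → k ≢ i → k ≢ j → PC.transpose i j k ≡ k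
transpose-fixes {i = i} {j} {k} k≢i k≢j rewrite dec-false (k ≟ i) k≢i | dec-false (k ≟ j) k≢j = refl

permutation-01 : ∀ {m} {p p′ : Fin (2 + m)} → p ≢ p′ →
                 ∃ λ (π : Permutation′ (2 + m)) → π ⟨$⟩ʳ p ≡ 0F × π ⟨$⟩ʳ p′ ≡ 1F
permutation-01 {p = p} {p′} p≢p′ = transpose p 0F ∘ₚ transpose c 1F , πp≡0 , transpose-sends c 1F
  where
  c = PC.transpose p 0F p′
  0≢c : 0F ≢ c
  0≢c 0≡c = p≢p′ (Injection.injective (↔⇒↣ (transpose p 0F)) (trans (transpose-sends p 0F) 0≡c))
  πp≡0 : PC.transpose c 1F (PC.transpose p 0F p) ≡ 0F
  πp≡0 rewrite transpose-sends p 0F = transpose-fixes 0≢c λ ()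

toℕ<2 : ∀ {m} (i : Fin (2 + m)) → toℕ i < 2 → i ≡ 0F ⊎ i ≡ 1F
toℕ<2 0F _ = inj₁ refl
toℕ<2 1F _ = inj₂ refl
toℕ<2 (suc (suc _)) (s≤s (s≤s ()))

≅K2∪K : ∀ {m} (G : Graph (2 + m)) (P : Fin (2 + m) → Set) {p p′} → p ≢ p′ →
        (∀ {x} → P x → x ≡ p ⊎ x ≡ p′) → P p → P p′ →
        (∀ {x y} → Adj G x y → SameSide P x y) →
        (∀ {x y} → x ≢ y → SameSide P x y → Adj G x y) → G ≅ K2∪K m
≅K2∪K G P {p} {p′} p≢p′ P⇒pair Pp Pp′ adj⇒sameSide sameSide⇒adj with permutation-01 p≢p′
... | π , πp≡0 , πp′≡1 = π , λ x y → preserve {x} {y} , reflect {x} {y}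
  where
  πx≡πy⇒x≡y : ∀ {x y} → toℕ (π ⟨$⟩ʳ x) ≡ toℕ (π ⟨$⟩ʳ y) → x ≡ y
  πx≡πy⇒x≡y = Injection.injective (↔⇒↣ π) ∘ toℕ-injective
  P⇒<2 : ∀ {x} → P x → toℕ (π ⟨$⟩ʳ x) < 2
  P⇒<2 Px with P⇒pair Px
  ... | inj₁ refl rewrite πp≡0  = s≤s z≤n
  ... | inj₂ refl rewrite πp′≡1 = s≤s (s≤s z≤n)
  <2⇒P : ∀ {x} → toℕ (π ⟨$⟩ʳ x) < 2 → P x
  <2⇒P {x} πx<2 with toℕ<2 (π ⟨$⟩ʳ x) πx<2
  ... | inj₁ πx≡0 = subst P (πx≡πy⇒x≡y (cong toℕ (trans πp≡0 (sym πx≡0)))) Pp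
  ... | inj₂ πx≡1 = subst P (πx≡πy⇒x≡y (cong toℕ (trans πp′≡1 (sym πx≡1)))) Pp′
  preserve : ∀ {x y} → Adj G x y → Adj (K2∪K _) (π ⟨$⟩ʳ x) (π ⟨$⟩ʳ y)
  preserve {x} {y} xy =
    (λ eq → irrefl G (subst (Adj G x) (sym (πx≡πy⇒x≡y {x} {y} eq)) xy)) ,
    SameSide-map {x = x} {y} P⇒<2 <2⇒P (adj⇒sameSide xy)
  reflect : ∀ {x y} → Adj (K2∪K _) (π ⟨$⟩ʳ x) (π ⟨$⟩ʳ y) → Adj G x y
  reflect {x} {y} (πx≢πy , sameSide) =
    sameSide⇒adj (πx≢πy ∘ cong (λ z → toℕ (π ⟨$⟩ʳ z))) (SameSide-map {x = x} {y} <2⇒P P⇒<2 sameSide)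

¬dominates-<2 : ∀ (G : Graph n) → Fin n → ∀ ys → length ys < 2 → ¬ Dominates G ys
¬dominates-<2 G v []          _ dom with dom v
... | ()
¬dominates-<2 G v (x ∷ [])    _ dom with dom x
... | here xx = irrefl G xx
¬dominates-<2 G v (_ ∷ _ ∷ _) (s≤s (s≤s ()))

¬dominates-<3 : ∀ (G : Graph n) → Fin n → NoDominatingPair G → ∀ ys → length ys < 3 → ¬ Dominates G ys
¬dominates-<3 G v noPair (a ∷ b ∷ [])    _ = noPair a b
¬dominates-<3 G v noPair (_ ∷ _ ∷ _ ∷ _) (s≤s (s≤s (s≤s ())))
¬dominates-<3 G v noPair ys@[]           _ = ¬dominates-<2 G v ys (s≤s z≤n)
¬dominates-<3 G v noPair ys@(_ ∷ [])     _ = ¬dominates-<2 G v ys (s≤s (s≤s z≤n))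

¬dominates-<4 : ∀ (G : Graph n) → Fin n → NoDominatingPair G → NoDominatingTriple G →
                ∀ ys → length ys < 4 → ¬ Dominates G ys
¬dominates-<4 G v noPair noTriple (a ∷ b ∷ c ∷ [])    _ = noTriple a b c
¬dominates-<4 G v noPair noTriple (_ ∷ _ ∷ _ ∷ _ ∷ _) (s≤s (s≤s (s≤s (s≤s ()))))
¬dominates-<4 G v noPair noTriple ys@[]               _ = ¬dominates-<3 G v noPair ys (s≤s z≤n)
¬dominates-<4 G v noPair noTriple ys@(_ ∷ [])         _ = ¬dominates-<3 G v noPair ys (s≤s (s≤s z≤n))
¬dominates-<4 G v noPair noTriple ys@(_ ∷ _ ∷ [])     _ = ¬dominates-<3 G v noPair ys (s≤s (s≤s (s≤s z≤n)))

module _ {m} (G : Graph (2 + m)) (split : ∀ {u v} → NonEdge G u v → Splits G u v) where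

  open TwoCliques G split

  private
    ThirdVertex : Fin (2 + m) → Fin (2 + m) → Set
    ThirdVertex u u′ = ∃ λ w → N⟨ G ⟩[ u ] w × w ≢ u × w ≢ u′

    thirdVertex? : ∀ u u′ → Dec (ThirdVertex u u′)
    thirdVertex? u u′ = any? λ w → ((w ≟ u) ⊎-dec dec G u w) ×-dec (¬? (w ≟ u) ×-dec ¬? (w ≟ u′))

    ≅K2∪K-via : ∀ {u v u′} → NonEdge G u v → Adj G u u′ → ¬ ThirdVertex u u′ → G ≅ K2∪K m
    ≅K2∪K-via {u} {u′ = u′} uv uu′ noThird =
      ≅K2∪K G N⟨ G ⟩[ u ] u≢u′ pair (inj₁ refl) (inj₂ uu′) (adj⇒sameSide uv) (sameSide⇒adj uv)
      where
      u≢u′ = λ u≡u′ → irrefl G (subst (Adj G u) (sym u≡u′) uu′)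
      pair : ∀ {x} → N⟨ G ⟩[ u ] x → x ≡ u ⊎ x ≡ u′
      pair {x} ux with x ≟ u | x ≟ u′
      ... | yes x≡u | _        = inj₁ x≡u
      ... | _       | yes x≡u′ = inj₂ x≡u′
      ... | no x≢u  | no x≢u′  = ⊥-elim (noThird (x , ux , x≢u , x≢u′))

  -- If N[u] and N[v] both had a third vertex, f would carry weight 3 + 3 on them.
  splitGraph≅K2∪K : NoIsolated G → ∀ {u v} → NonEdge G u v →
                    ∀ {f} → IsTRDF G f → weight f ≤ 5 → G ≅ K2∪K m
  splitGraph≅K2∪K noIsolated {u} {v} uv {f} isTRDF weight≤5
    with noIsolated u | noIsolated v
  ... | u′ , uu′ | v′ , vv′ with thirdVertex? u u′ | thirdVertex? v v′
  ... | no noThird | _          = ≅K2∪K-via uv uu′ noThird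
  ... | _          | no noThird = ≅K2∪K-via (NonEdge-sym G uv) vv′ noThird
  ... | yes (w , uw , w≢u , w≢u′) | yes (z , vz , z≢v , z≢v′) =
    ⊥-elim (<⇒≱ (s≤s weight≤5) (carries-disjoint (disjoint uv)
                                  (carries3 uv uu′ uw w≢u w≢u′)
                                  (carries3 (NonEdge-sym G uv) vv′ vz z≢v z≢v′)))
    where
    carries3 : ∀ {u v u′ w} → NonEdge G u v → Adj G u u′ → N⟨ G ⟩[ u ] w → w ≢ u → w ≢ u′ →
               Carries f N⟨ G ⟩[ u ] 3
    carries3 {u} uv uu′ uw w≢u w≢u′ =
      closedSet-carries3 G isTRDF (λ ux xy → closed uv ux (inj₂ xy)) (inj₁ refl) (inj₂ uu′) uw
        (λ u≡u′ → irrefl G (subst (Adj G u) (sym u≡u′) uu′)) (≢-sym w≢u) (≢-sym w≢u′)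

dominatingPair⇒γt≡2 : ∀ (G : Graph n) {a b} → Dominates G (a ∷ b ∷ []) → γt≡ G 2
dominatingPair⇒γt≡2 G {a} dom = γt≡-intro G dom (¬dominates-<2 G a)

dominatingTriple⇒γt≡3 : ∀ (G : Graph n) {a b c} → NoDominatingPair G →
                        Dominates G (a ∷ b ∷ c ∷ []) → γt≡ G 3
dominatingTriple⇒γt≡3 G {a} noPair dom = γt≡-intro G dom (¬dominates-<3 G a noPair)

splits⇒γt≡4 : ∀ (G : Graph n) → NoIsolated G → NoDominatingPair G → NoDominatingTriple G →
              ∀ {u v} → Splits G u v → γt≡ G 4
splits⇒γt≡4 G noIsolated noPair noTriple {u} {v} (cover , _)
  with noIsolated u | noIsolated v
... | u′ , uu′ | v′ , vv′ = γt≡-intro G dom (¬dominates-<4 G u noPair noTriple)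
  where
  dom : Dominates G (u′ ∷ u ∷ v′ ∷ v ∷ [])
  dom w with cover w
  ... | inj₁ (inj₁ refl) = here uu′
  ... | inj₁ (inj₂ uw)   = there (here (symm G uw))
  ... | inj₂ (inj₁ refl) = there (there (here vv′))
  ... | inj₂ (inj₂ vw)   = there (there (there (here (symm G vw))))

module 5-γtR-EdgeCritical {n} (G : Graph n) (noIsolated : NoIsolated G)
  (minimal : ∀ f → IsTRDF G f → 5 ≤ weight f)
  (critical : ∀ u v (e : NonEdge G u v) → ∃ λ k → γtR≡ (addEdge G u v e) k × k < 5) where

  5≤order : 5 ≤ n
  5≤order = γtR≤order G noIsolated minimal

  noDominatingPair : NoDominatingPair G
  noDominatingPair a b dom with dominates⇒TRDF G dom
  ... | f , isTRDF , weight≤4 = <⇒≱ (s≤s weight≤4) (minimal f isTRDF)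

  addEdge-dominatingPair : ∀ {u v} (e : NonEdge G u v) →
                           ∃₂ λ a b → Dominates (addEdge G u v e) (a ∷ b ∷ [])
  addEdge-dominatingPair {u} {v} e with critical u v e
  ... | k , ((f , isTRDF , weight≡k) , _) , k<5 =
    lightTRDF⇒dominatingPair (addEdge G u v e) 5≤order isTRDF (subst (_≤ 4) (sym weight≡k) (≤-pred k<5))

  addEdge-γt≡2 : ∀ u v (e : NonEdge G u v) → γt≡ (addEdge G u v e) 2
  addEdge-γt≡2 u v e =
    dominatingPair⇒γt≡2 (addEdge G u v e) (proj₂ (proj₂ (addEdge-dominatingPair e)))

  splits : NoDominatingTriple G → ∀ {u v} → NonEdge G u v → Splits G u v
  splits noTriple e =
    splits-of-dominatingPair G e noIsolated noTriple (proj₂ (proj₂ (addEdge-dominatingPair e)))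

dominatingTriple-or-none : ∀ (G : Graph n) →
                           (∃ λ a → ∃₂ λ b c → Dominates G (a ∷ b ∷ c ∷ [])) ⊎ NoDominatingTriple G
dominatingTriple-or-none G with any? (λ a → any? λ b → any? λ c → dominates? G (a ∷ b ∷ c ∷ []))
... | yes triple  = inj₁ triple
... | no noTriple = inj₂ λ a b c dom → noTriple (a , b , c , dom)

mainTheorem11 : ∀ {N : ℕ} (G : Graph N) → NoIsolated G → γtREdgeCritical 5 G →
    γtEdgeCritical 3 G ⊎
    (Σ ℕ λ n → n ≥ 3 × G ≅ K2∪K n × γtEdgeSupercritical 4 G)
mainTheorem11 {0} G noIsolated ((_ , minimal) , _) =
  contradiction (γtR≤order G noIsolated minimal) λ ()
mainTheorem11 {1} G noIsolated ((_ , minimal) , _) =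
  contradiction (γtR≤order G noIsolated minimal) λ { (s≤s ()) }
mainTheorem11 {suc (suc n)} G noIsolated
  (((f , isTRDF , weight≡5) , minimal) , nonEdge@(_ , _ , uv) , critical)
  with dominatingTriple-or-none G
... | inj₁ (_ , _ , _ , dom) =
  inj₁ (dominatingTriple⇒γt≡3 G noDominatingPair dom , nonEdge , λ u v e → 2 , addEdge-γt≡2 u v e , ≤-refl)
  where open 5-γtR-EdgeCritical G noIsolated minimal critical
... | inj₂ noTriple =
  inj₂ (n , ≤-pred (≤-pred 5≤order)
       , splitGraph≅K2∪K G (splits noTriple) noIsolated uv isTRDF (≤-reflexive weight≡5)
       , splits⇒γt≡4 G noIsolated noDominatingPair noTriple (splits noTriple uv) , nonEdge , addEdge-γt≡2)
  where open 5-γtR-EdgeCritical G noIsolated minimal critical
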